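{- Let $(X,\mathcal{B})$ be a Steiner triple system of order $v$. If $Y \subseteq X$ with $|Y| = s$ and $\mathcal{C} \subseteq \mathcal{B}$ with $|\mathcal{C}| = t$ form a nonincident set of points and blocks (i.e., $y \notin B$ for every $y \in Y$ and every $B \in \mathcal{C}$), then \[ t \leq \frac{v(v-1)+s^2 - s(2v-1)}{6}. \]
   Context: A Steiner triple system of order $v$ (STS$(v)$) is a pair $(X,\mathcal{B})$ where $X$ is a set of $v$ points and $\mathcal{B}$ is a set of $3$-element subsets of $X$ (blocks) such that every pair of distinct points of $X$ is contained in exactly one block. -}

module Defs where

open import Data.Nat using (ℕ)
open import Data.Fin using (Fin)
open import Data.Fin.Subset using (Subset; _∈_; _∉_; ∣_∣)
open import Data.List using (List)
open import Data.List.Relation.Unary.All using (All)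
open import Data.List.Relation.Unary.Unique.Propositional using (Unique)
import Data.List.Membership.Propositional as LM
open import Data.Product using (Σ; _×_)
open import Relation.Binary.PropositionalEquality using (_≡_)
open import Relation.Nullary using (¬_)

record STS (v : ℕ) : Set where
  field
    blocks        : List (Subset v)
    blocks-unique : Unique blocks
    block-size    : All (λ B → ∣ B ∣ ≡ 3) blocks
    pair-covered  : (x y : Fin v) → ¬ x ≡ y →
                    Σ (Subset v) λ B → (B LM.∈ blocks) × (x ∈ B) × (y ∈ B)
    pair-unique   : (x y : Fin v) → ¬ x ≡ y → (B B′ : Subset v) →
                    B LM.∈ blocks → B′ LM.∈ blocks →
                    x ∈ B → y ∈ B → x ∈ B′ → y ∈ B′ → B ≡ B′

Nonincident : {v : ℕ} → Subset v → List (Subset v) → Set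
Nonincident {v} Y 𝒞 = (y : Fin v) → y ∈ Y → (B : Subset v) → B LM.∈ 𝒞 → y ∉ B

-- Let Z be the complement of Y, with n = v − s points. Every block of 𝒞 lies
-- inside Z and contains 3 · 2 = 6 ordered pairs of distinct points of Z, and no
-- such pair lies in two blocks, so double counting gives 6t ≤ n(n − 1).
-- Expanding n(n − 1) with n = v − s gives the stated bound.
module Submission where

open import Defs
open import Data.Nat using (ℕ; _+_; _*_; _∸_; _≤_)
open import Data.Fin.Subset using (Subset; ∣_∣)
open import Data.List using (List; length)
open import Data.List.Relation.Unary.All using (All)
open import Data.List.Relation.Unary.Unique.Propositional using (Unique)
open import Data.List.Membership.Propositional using (_∈_)
open import Relation.Binary.PropositionalEquality using (_≡_)

open import Data.Bool using (if_then_else_)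
open import Data.Fin using (Fin; zero; suc)
open import Data.Fin.Properties using (_≟_; suc-injective; 0≢1+n)
open import Data.Fin.Subset using (inside; outside; ∁; _⊆_)
import Data.Fin.Subset as Subset
open import Data.Fin.Subset.Properties using (_∈?_; x∉p⇒x∈∁p; ∣∁p∣≡n∸∣p∣; ∣p∣≤n)
open import Data.List using (lookup)
open import Data.List.Membership.Propositional.Properties using (∈-lookup)
import Data.List.Relation.Unary.All as All
open import Data.List.Relation.Unary.AllPairs using (_∷_)
open import Data.Nat using (zero; suc; z≤n; s≤s)
open import Data.Nat.Properties
  using (+-*-semiring; *-identityʳ; *-suc; *-comm; +-comm; +-mono-≤; +-monoˡ-≤; +-cancelʳ-≡;
         ≤-reflexive; m∸n+n≡m; module ≤-Reasoning)
open import Algebra.Properties.Semiring.Sum +-*-semiring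
  using (sum-syntax; ∑-comm; ∑-distrib-+; *-distribˡ-sum; *-distribʳ-sum; sum-cong-≗;
         sum-replicate-zero)
open import Data.Nat.Tactic.RingSolver using (solve-∀)
open import Data.Product using (_×_; _,_)
open import Data.Vec using ([]; _∷_)
open import Function using (_∘_)
open import Relation.Binary.PropositionalEquality using (refl; sym; trans; cong; module ≡-Reasoning)
open import Relation.Nullary using (¬_; Dec; yes; no; does; contradiction)
open import Relation.Nullary.Decidable using (¬?; _×-dec_)

𝟙 : ∀ {a} {A : Set a} → Dec A → ℕ
𝟙 a? = if does a? then 1 else 0

∑-const : ∀ m c → ∑[ k < m ] c ≡ m * c
∑-const zero    c = refl
∑-const (suc m) c = cong (c +_) (∑-const m c)

∑-mono-≤ : ∀ {m} {f g : Fin m → ℕ} → (∀ k → f k ≤ g k) → ∑[ k < m ] f k ≤ ∑[ k < m ] g k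
∑-mono-≤ {zero}  f≤g = z≤n
∑-mono-≤ {suc m} f≤g = +-mono-≤ (f≤g zero) (∑-mono-≤ (f≤g ∘ suc))

∑𝟙≡0 : ∀ {m p} {P : Fin m → Set p} (P? : ∀ k → Dec (P k)) →
       (∀ k → ¬ P k) → ∑[ k < m ] 𝟙 (P? k) ≡ 0
∑𝟙≡0 {zero}  P? ¬P = refl
∑𝟙≡0 {suc m} P? ¬P with P? zero
... | yes P0 = contradiction P0 (¬P zero)
... | no _   = ∑𝟙≡0 (P? ∘ suc) (¬P ∘ suc)

∑𝟙≤1 : ∀ {m p} {P : Fin m → Set p} (P? : ∀ k → Dec (P k)) →
       (∀ {k l} → P k → P l → k ≡ l) → ∑[ k < m ] 𝟙 (P? k) ≤ 1
∑𝟙≤1 {zero}  P? unique = z≤n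
∑𝟙≤1 {suc m} P? unique with P? zero
... | yes P0 = s≤s (≤-reflexive (∑𝟙≡0 (P? ∘ suc) (λ k Pk → 0≢1+n (unique P0 Pk))))
... | no _   = ∑𝟙≤1 (P? ∘ suc) (λ Pk Pl → suc-injective (unique Pk Pl))

∑𝟙≤𝟙 : ∀ {m p q} {P : Fin m → Set p} {Q : Set q} (P? : ∀ k → Dec (P k)) (Q? : Dec Q) →
       (∀ {k} → P k → Q) → (∀ {k l} → P k → P l → k ≡ l) → ∑[ k < m ] 𝟙 (P? k) ≤ 𝟙 Q?
∑𝟙≤𝟙 P? (yes _)  _   unique = ∑𝟙≤1 P? unique
∑𝟙≤𝟙 P? (no ¬Q) P⇒Q _      = ≤-reflexive (∑𝟙≡0 P? (λ k → ¬Q ∘ P⇒Q))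

∣p∣≡∑𝟙-∈ : ∀ {n} (p : Subset n) → ∣ p ∣ ≡ ∑[ x < n ] 𝟙 (x ∈? p)
∣p∣≡∑𝟙-∈ []            = refl
∣p∣≡∑𝟙-∈ (inside ∷ p)  = cong suc (∣p∣≡∑𝟙-∈ p)
∣p∣≡∑𝟙-∈ (outside ∷ p) = ∣p∣≡∑𝟙-∈ p

∑𝟙-≟ : ∀ {n} (x : Fin n) → ∑[ y < n ] 𝟙 (x ≟ y) ≡ 1
∑𝟙-≟ {suc n} zero    = cong suc (sum-replicate-zero n)
∑𝟙-≟ {suc n} (suc x) = ∑𝟙-≟ x

Pair : ∀ {n} → Subset n → Fin n → Fin n → Set
Pair p x y = x Subset.∈ p × y Subset.∈ p × ¬ x ≡ y

pair? : ∀ {n} (p : Subset n) x y → Dec (Pair p x y)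
pair? p x y = x ∈? p ×-dec y ∈? p ×-dec ¬? (x ≟ y)

Pair-mono : ∀ {n} {p q : Subset n} {x y} → p ⊆ q → Pair p x y → Pair q x y
Pair-mono p⊆q (x∈p , y∈p , x≢y) = p⊆q x∈p , p⊆q y∈p , x≢y

orderedPairs : ∀ {n} → Subset n → ℕ
orderedPairs {n} p = ∑[ x < n ] ∑[ y < n ] 𝟙 (pair? p x y)

𝟙-∈*𝟙-∈-split : ∀ {n} (p : Subset n) x y →
                𝟙 (x ∈? p) * 𝟙 (y ∈? p) ≡ 𝟙 (pair? p x y) + 𝟙 (x ∈? p) * 𝟙 (x ≟ y)
𝟙-∈*𝟙-∈-split p x y with x ≟ y | x ∈? p | y ∈? p
... | yes refl | yes _  | yes _  = refl
... | yes refl | yes x∈ | no x∉  = contradiction x∈ x∉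
... | yes refl | no _   | _      = refl
... | no _     | yes _  | yes _  = refl
... | no _     | yes _  | no _   = refl
... | no _     | no _   | _      = refl

∑𝟙-pair+𝟙-∈ : ∀ {n} (p : Subset n) x →
              ∑[ y < n ] 𝟙 (pair? p x y) + 𝟙 (x ∈? p) ≡ 𝟙 (x ∈? p) * ∣ p ∣
∑𝟙-pair+𝟙-∈ {n} p x = begin
  ∑[ y < n ] 𝟙 (pair? p x y) + 𝟙 (x ∈? p)
    ≡⟨ cong (∑[ y < n ] 𝟙 (pair? p x y) +_) (sym (*-identityʳ (𝟙 (x ∈? p)))) ⟩
  ∑[ y < n ] 𝟙 (pair? p x y) + 𝟙 (x ∈? p) * 1
    ≡⟨ cong (λ k → ∑[ y < n ] 𝟙 (pair? p x y) + 𝟙 (x ∈? p) * k) (sym (∑𝟙-≟ x)) ⟩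
  ∑[ y < n ] 𝟙 (pair? p x y) + 𝟙 (x ∈? p) * ∑[ y < n ] 𝟙 (x ≟ y)
    ≡⟨ cong (∑[ y < n ] 𝟙 (pair? p x y) +_) (*-distribˡ-sum (𝟙 (x ∈? p)) (λ y → 𝟙 (x ≟ y))) ⟩
  ∑[ y < n ] 𝟙 (pair? p x y) + ∑[ y < n ] (𝟙 (x ∈? p) * 𝟙 (x ≟ y))
    ≡⟨ sym (∑-distrib-+ (λ y → 𝟙 (pair? p x y)) (λ y → 𝟙 (x ∈? p) * 𝟙 (x ≟ y))) ⟩
  ∑[ y < n ] (𝟙 (pair? p x y) + 𝟙 (x ∈? p) * 𝟙 (x ≟ y))
    ≡⟨ sum-cong-≗ (λ y → sym (𝟙-∈*𝟙-∈-split p x y)) ⟩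
  ∑[ y < n ] (𝟙 (x ∈? p) * 𝟙 (y ∈? p))
    ≡⟨ sym (*-distribˡ-sum (𝟙 (x ∈? p)) (λ y → 𝟙 (y ∈? p))) ⟩
  𝟙 (x ∈? p) * ∑[ y < n ] 𝟙 (y ∈? p)
    ≡⟨ cong (𝟙 (x ∈? p) *_) (sym (∣p∣≡∑𝟙-∈ p)) ⟩
  𝟙 (x ∈? p) * ∣ p ∣ ∎
  where open ≡-Reasoning

orderedPairs≡∣p∣*[∣p∣∸1] : ∀ {n} (p : Subset n) → orderedPairs p ≡ ∣ p ∣ * (∣ p ∣ ∸ 1)
orderedPairs≡∣p∣*[∣p∣∸1] {n} p = +-cancelʳ-≡ ∣ p ∣ _ _ (begin
  orderedPairs p + ∣ p ∣
    ≡⟨ cong (orderedPairs p +_) (∣p∣≡∑𝟙-∈ p) ⟩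
  orderedPairs p + ∑[ x < n ] 𝟙 (x ∈? p)
    ≡⟨ sym (∑-distrib-+ (λ x → ∑[ y < n ] 𝟙 (pair? p x y)) (λ x → 𝟙 (x ∈? p))) ⟩
  ∑[ x < n ] (∑[ y < n ] 𝟙 (pair? p x y) + 𝟙 (x ∈? p))
    ≡⟨ sum-cong-≗ (∑𝟙-pair+𝟙-∈ p) ⟩
  ∑[ x < n ] (𝟙 (x ∈? p) * ∣ p ∣)
    ≡⟨ sym (*-distribʳ-sum ∣ p ∣ (λ x → 𝟙 (x ∈? p))) ⟩
  (∑[ x < n ] 𝟙 (x ∈? p)) * ∣ p ∣
    ≡⟨ cong (_* ∣ p ∣) (sym (∣p∣≡∑𝟙-∈ p)) ⟩
  ∣ p ∣ * ∣ p ∣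
    ≡⟨ m*m≡m*[m∸1]+m ∣ p ∣ ⟩
  ∣ p ∣ * (∣ p ∣ ∸ 1) + ∣ p ∣ ∎)
  where
  open ≡-Reasoning
  m*m≡m*[m∸1]+m : ∀ m → m * m ≡ m * (m ∸ 1) + m
  m*m≡m*[m∸1]+m zero    = refl
  m*m≡m*[m∸1]+m (suc m) = trans (*-suc (suc m) m) (+-comm (suc m) _)

lookup-injective : ∀ {a} {A : Set a} {xs : List A} → Unique xs →
                   ∀ {i j} → lookup xs i ≡ lookup xs j → i ≡ j
lookup-injective (_  ∷ _) {zero}  {zero}  _  = refl
lookup-injective (x∉ ∷ _) {zero}  {suc j} eq = contradiction eq (All.lookup x∉ (∈-lookup j))
lookup-injective (x∉ ∷ _) {suc i} {zero}  eq = contradiction (sym eq) (All.lookup x∉ (∈-lookup i))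
lookup-injective (_  ∷ u) {suc i} {suc j} eq = cong suc (lookup-injective u eq)

nonincident⇒⊆∁ : ∀ {v} {Y : Subset v} {𝒞 : List (Subset v)} → Nonincident Y 𝒞 → All (_⊆ ∁ Y) 𝒞
nonincident⇒⊆∁ nonincident =
  All.tabulate (λ B∈𝒞 y∈B → x∉p⇒x∈∁p (λ y∈Y → nonincident _ y∈Y _ B∈𝒞 y∈B))

module _ {v} (S : STS v) where
  open STS S

  orderedPairs-block : ∀ {B} → B ∈ blocks → orderedPairs B ≡ 6
  orderedPairs-block {B} B∈ =
    trans (orderedPairs≡∣p∣*[∣p∣∸1] B) (cong (λ k → k * (k ∸ 1)) (All.lookup block-size B∈))

  6*length≤orderedPairs : ∀ {Z : Subset v} {𝒞 : List (Subset v)} → Unique 𝒞 →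
                          All (_∈ blocks) 𝒞 → All (_⊆ Z) 𝒞 → 6 * length 𝒞 ≤ orderedPairs Z
  6*length≤orderedPairs {Z} {𝒞} unique 𝒞⊆blocks 𝒞⊆Z = begin
    6 * t
      ≡⟨ trans (*-comm 6 t) (sym (∑-const t 6)) ⟩
    ∑[ k < t ] 6
      ≡⟨ sum-cong-≗ (sym ∘ orderedPairs-block ∘ block) ⟩
    ∑[ k < t ] ∑[ x < v ] ∑[ y < v ] 𝟙 (pair? (B k) x y)
      ≡⟨ ∑-comm (λ k x → ∑[ y < v ] 𝟙 (pair? (B k) x y)) ⟩
    ∑[ x < v ] ∑[ k < t ] ∑[ y < v ] 𝟙 (pair? (B k) x y)
      ≡⟨ sum-cong-≗ (λ x → ∑-comm (λ k y → 𝟙 (pair? (B k) x y))) ⟩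
    ∑[ x < v ] ∑[ y < v ] ∑[ k < t ] 𝟙 (pair? (B k) x y)
      ≤⟨ ∑-mono-≤ (λ x → ∑-mono-≤ (atMostOneBlock x)) ⟩
    orderedPairs Z ∎
    where
    open ≤-Reasoning
    t = length 𝒞
    B : Fin t → Subset v
    B = lookup 𝒞
    block : ∀ k → B k ∈ blocks
    block k = All.lookup 𝒞⊆blocks (∈-lookup k)
    atMostOneBlock : ∀ x y → ∑[ k < t ] 𝟙 (pair? (B k) x y) ≤ 𝟙 (pair? Z x y)
    atMostOneBlock x y = ∑𝟙≤𝟙 (λ k → pair? (B k) x y) (pair? Z x y)
      (λ {k} → Pair-mono (All.lookup 𝒞⊆Z (∈-lookup k)))
      (λ {k} {l} (x∈ , y∈ , x≢y) (x∈′ , y∈′ , _) → lookup-injective unique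
        (pair-unique x y x≢y (B k) (B l) (block k) (block l) x∈ y∈ x∈′ y∈′))

2*suc∸1 : ∀ k → 2 * suc k ∸ 1 ≡ suc (2 * k)
2*suc∸1 k = cong (_∸ 1) (*-suc 2 k)

-- The case split only resolves the truncated subtractions for the ring solver.
falling-square-split : ∀ n s {v} → n + s ≡ v → n * (n ∸ 1) + s * (2 * v ∸ 1) ≡ v * (v ∸ 1) + s * s
falling-square-split zero    zero    refl = refl
falling-square-split zero    (suc s) refl = trans (cong (suc s *_) (2*suc∸1 s)) (ring s)
  where
  ring : ∀ s → suc s * suc (2 * s) ≡ suc s * s + suc s * suc s
  ring = solve-∀
falling-square-split (suc n) s       refl =
  trans (cong (λ e → suc n * n + s * e) (2*suc∸1 (n + s))) (ring n s)
  where
  ring : ∀ n s → suc n * n + s * suc (2 * (n + s)) ≡ suc (n + s) * (n + s) + s * s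
  ring = solve-∀

corollary2 : (v s t : ℕ) (S : STS v) (Y : Subset v) (𝒞 : List (Subset v)) →
             ∣ Y ∣ ≡ s → Unique 𝒞 → All (λ B → B ∈ STS.blocks S) 𝒞 → length 𝒞 ≡ t →
             Nonincident Y 𝒞 →
             6 * t + s * (2 * v ∸ 1) ≤ v * (v ∸ 1) + s * s
corollary2 v s t S Y 𝒞 refl unique 𝒞⊆blocks refl nonincident = begin
  6 * length 𝒞 + ∣ Y ∣ * (2 * v ∸ 1)
    ≤⟨ +-monoˡ-≤ (∣ Y ∣ * (2 * v ∸ 1))
         (6*length≤orderedPairs S unique 𝒞⊆blocks (nonincident⇒⊆∁ nonincident)) ⟩
  orderedPairs (∁ Y) + ∣ Y ∣ * (2 * v ∸ 1)
    ≡⟨ cong (_+ ∣ Y ∣ * (2 * v ∸ 1)) (orderedPairs≡∣p∣*[∣p∣∸1] (∁ Y)) ⟩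
  ∣ ∁ Y ∣ * (∣ ∁ Y ∣ ∸ 1) + ∣ Y ∣ * (2 * v ∸ 1)
    ≡⟨ falling-square-split ∣ ∁ Y ∣ ∣ Y ∣ ∣∁Y∣+∣Y∣≡v ⟩
  v * (v ∸ 1) + ∣ Y ∣ * ∣ Y ∣ ∎
  where
  open ≤-Reasoning
  ∣∁Y∣+∣Y∣≡v : ∣ ∁ Y ∣ + ∣ Y ∣ ≡ v
  ∣∁Y∣+∣Y∣≡v = trans (cong (_+ ∣ Y ∣) (∣∁p∣≡n∸∣p∣ Y)) (m∸n+n≡m (∣p∣≤n Y))
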